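{- Let $H$ be a finite graph containing a triangle. If $e(H)$ is odd, then the coefficient of $p^3$ in $\Delta_H(p)$ is positive; if $e(H)$ is even, then the coefficient of $p^3$ in $\Delta_H(p)$ is negative.
   Context: For $p\in[0,1]$ define the kernel $U_p:[0,1]^2\to\mathbb{R}$ by $U_p(x,y)=2p-1$ if $(x,y)\in[0,1/2)^2$ or $(x,y)\in[1/2,1]^2$, and $U_p(x,y)=-1$ otherwise. For a graph $H$, $t_H(U)=\int_{[0,1]^{v(H)}}\prod_{ij\in E(H)}U(x_i,x_j)\prod_i dx_i$, and $\Delta_H(p):=t_H(U_p)-(p-1)^{e(H)}$, a polynomial in $p$. -}

module Defs where

open import Data.Bool using (Bool; true; false; T; if_then_else_)
open import Data.Nat using (ℕ; zero; suc; _<ᵇ_)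
open import Data.Fin using (Fin; toℕ)
open import Data.List using (List; []; _∷_; map; foldr; filterᵇ; concatMap; length; allFin; cartesianProduct)
open import Data.Product using (_×_; _,_; proj₁; proj₂)
open import Data.Rational using (ℚ; 0ℚ; 1ℚ; ½; _+_; _*_; -_)
open import Data.Vec.Functional using (Vector) renaming (_∷_ to _∷ᵥ_)
open import Relation.Binary.PropositionalEquality using (_≡_; _≢_)

record Graph (n : ℕ) : Set where
  field
    adj    : Fin n → Fin n → Bool
    sym    : ∀ i j → adj i j ≡ adj j i
    irrefl : ∀ i → adj i i ≡ false
open Graph public

edges : ∀ {n} → Graph n → List (Fin n × Fin n)
edges {n} G = filterᵇ (λ ij → (toℕ (proj₁ ij) <ᵇ toℕ (proj₂ ij)) Data.Bool.∧ adj G (proj₁ ij) (proj₂ ij))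
                      (cartesianProduct (allFin n) (allFin n))

e : ∀ {n} → Graph n → ℕ
e G = length (edges G)

ContainsTriangle : ∀ {n} → Graph n → Set
ContainsTriangle {n} G =
  Data.Product.Σ (Fin n) λ a → Data.Product.Σ (Fin n) λ b → Data.Product.Σ (Fin n) λ c →
    T (adj G a b) × T (adj G b c) × T (adj G a c)

-- Polynomials over ℚ as coefficient lists (index k = coefficient of p^k)

Poly : Set
Poly = List ℚ

_+ₚ_ : Poly → Poly → Poly
[] +ₚ q = q
(a ∷ p) +ₚ [] = a ∷ p
(a ∷ p) +ₚ (b ∷ q) = (a + b) ∷ (p +ₚ q)

scaleₚ : ℚ → Poly → Poly
scaleₚ c p = map (c *_) p

_*ₚ_ : Poly → Poly → Poly
[] *ₚ q = []
(a ∷ p) *ₚ q = scaleₚ a q +ₚ (0ℚ ∷ (p *ₚ q))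

negₚ : Poly → Poly
negₚ = scaleₚ (- 1ℚ)

oneₚ : Poly
oneₚ = 1ℚ ∷ []

_^ₚ_ : Poly → ℕ → Poly
p ^ₚ zero = oneₚ
p ^ₚ suc k = p *ₚ (p ^ₚ k)

sumₚ : List Poly → Poly
sumₚ = foldr _+ₚ_ []

prodₚ : List Poly → Poly
prodₚ = foldr _*ₚ_ oneₚ

coeff : Poly → ℕ → ℚ
coeff [] k = 0ℚ
coeff (a ∷ p) zero = a
coeff (a ∷ p) (suc k) = coeff p k

-- The kernel U_p.  A point x ∈ [0,1] is recorded by which half it lies in:
-- false ↔ [0,1/2), true ↔ [1/2,1].  U_p is constant on the four cells:
-- 2p-1 on the diagonal cells, -1 off them.

Uₚ : Bool → Bool → Poly
Uₚ false false = (- 1ℚ) ∷ (1ℚ + 1ℚ) ∷ []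
Uₚ true  true  = (- 1ℚ) ∷ (1ℚ + 1ℚ) ∷ []
Uₚ false true  = (- 1ℚ) ∷ []
Uₚ true  false = (- 1ℚ) ∷ []

assignments : (n : ℕ) → List (Vector Bool n)
assignments zero = (λ ()) ∷ []
assignments (suc n) = concatMap (λ f → (false ∷ᵥ f) ∷ (true ∷ᵥ f) ∷ []) (assignments n)

halfPow : ℕ → ℚ
halfPow zero = 1ℚ
halfPow (suc k) = ½ * halfPow k

-- t_H(U_p) as a polynomial in p: the integrand is a step function constant
-- on each of the 2^n cells (each of measure 2^{-n}); boundaries are null.
tH : ∀ {n} → Graph n → Poly
tH {n} G = scaleₚ (halfPow n)
  (sumₚ (map (λ σ → prodₚ (map (λ ij → Uₚ (σ (proj₁ ij)) (σ (proj₂ ij))) (edges G)))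
             (assignments n)))

ΔH : ∀ {n} → Graph n → Poly
ΔH G = tH G +ₚ negₚ (((- 1ℚ) ∷ 1ℚ ∷ []) ^ₚ e G)

-- On the cell of [0,1]^n fixed by σ : Fin n → Bool (which half each vertex lies in), the kernel
-- on an edge ij is the linear polynomial t·p − 1 with slope t = 1 + χ_ij(σ) ∈ {0, 2}, where
-- χ_ij(σ) = ±1 records whether i and j lie in the same half.  By Vieta, the coefficient of p^k
-- in Δ_H is therefore (−1)^(e(H)+k) times the mean over σ of e_k(1 + χ) − e_k(1, …, 1).
-- Expanding e_k(1 + χ) shows that this excess is a nonnegative combination of products of
-- characters, and every product of characters has nonnegative mean.  For k = 3 the combination
-- contains the product of the three characters of a triangle, which is identically 1, so the
-- mean excess is at least 1 and the sign of the p^3 coefficient is (−1)^(e(H)+1).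

{-# OPTIONS --safe #-}
module Submission where

open import Defs hiding (sym)
open import Algebra.Bundles using (CommutativeMonoid)
open import Data.Bool using (Bool; true; false; T; _∧_; not)
open import Data.Bool.Properties using (T-∧)
open import Data.Empty using (⊥-elim)
open import Data.Fin using (Fin; toℕ) renaming (zero to fzero; suc to fsuc)
open import Data.Fin.Properties using (toℕ-injective)
open import Data.List using (List; []; _∷_; _++_; map; foldr; length; concatMap)
open import Data.List.Properties using (length-map; map-∘)
open import Data.List.Membership.Propositional using (_∈_; _∉_)
open import Data.List.Membership.Propositional.Properties using (∈-filter⁺; ∈-cartesianProduct⁺; ∈-allFin)
open import Data.List.Relation.Binary.Permutation.Propositional as ↭ using (_↭_; ↭-refl)
open import Data.List.Relation.Binary.Permutation.Propositional.Properties as ↭ using (∈-resp-↭; ↭-length)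
open import Data.List.Relation.Binary.Sublist.Propositional using (_⊆_; []; _∷_; _∷ʳ_; minimum)
open import Data.List.Relation.Binary.Sublist.Propositional.Properties as ⊆ using ()
open import Data.List.Relation.Unary.All as All using (All; []; _∷_)
open import Data.List.Relation.Unary.All.Properties as All using ()
open import Data.List.Relation.Unary.AllPairs using ([]; _∷_)
open import Data.List.Relation.Unary.Any using (here; there)
open import Data.List.Relation.Unary.Unique.Propositional using (Unique)
open import Data.Nat using (ℕ; zero; suc; _%_) renaming (_<_ to _<ℕ_)
open import Data.Nat.Properties using (<⇒<ᵇ; <-cmp)
open import Data.Product using (_×_; _,_; proj₁; proj₂; ∃-syntax)
open import Data.Rational using (ℚ; 0ℚ; 1ℚ; ½; _+_; _*_; -_; _-_; _≤_; _<_; nonNegative)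
open import Data.Rational.Properties
  using ( +-*-commutativeRing; *-1-commutativeMonoid; _≟_; module ≤-Reasoning
        ; ≤-refl; +-mono-≤; <-≤-trans; neg-antimono-<
        ; nonNegative⁻¹; positive⁻¹; nonNeg*nonNeg⇒nonNeg
        ; +-identityˡ; +-identityʳ; +-assoc; *-identityˡ; *-identityʳ; *-zeroʳ; *-assoc; *-comm
        ; *-distribˡ-+; *-distribʳ-+; neg-distribˡ-* )
open import Algebra.Properties.CommutativeSemigroup (CommutativeMonoid.commutativeSemigroup *-1-commutativeMonoid)
  using () renaming (x∙yz≈y∙xz to *-exchange)
open import Data.Sum using (_⊎_; inj₁; inj₂)
import Data.Sum as Sum
open import Data.Vec.Functional using (Vector) renaming (_∷_ to _∷ᵥ_)
open import Function using (_∘_; Equivalence)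
open import Level using (0ℓ)
open import Relation.Binary.Definitions using (tri<; tri≈; tri>)
open import Relation.Binary.PropositionalEquality
  using (_≡_; _≢_; _≗_; refl; sym; trans; cong; cong₂; subst; module ≡-Reasoning)
open import Relation.Nullary.Decidable using (dec⇒maybe)
open import Tactic.RingSolver using (solve-∀)
open import Tactic.RingSolver.Core.AlmostCommutativeRing using (AlmostCommutativeRing; fromCommutativeRing)

-- The zero test lets the solver drop coefficients that cancel.
ℚ-ring : AlmostCommutativeRing 0ℓ 0ℓ
ℚ-ring = fromCommutativeRing +-*-commutativeRing (λ x → dec⇒maybe (0ℚ ≟ x))

variable
  n k : ℕ

-1^_ : ℕ → ℚ
-1^ zero  = 1ℚ
-1^ suc m = - (-1^ m)

-1^-even : ∀ m → m % 2 ≡ 0 → -1^ m ≡ 1ℚ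
-1^-odd  : ∀ m → m % 2 ≡ 1 → -1^ m ≡ - 1ℚ
-1^-even zero          _ = refl
-1^-even (suc (suc m)) p = cong (λ s → - - s) (-1^-even m p)
-1^-odd  (suc zero)    _ = refl
-1^-odd  (suc (suc m)) p = cong (λ s → - - s) (-1^-odd m p)

*-nonNeg : ∀ {p q} → 0ℚ ≤ p → 0ℚ ≤ q → 0ℚ ≤ p * q
*-nonNeg {p} {q} 0≤p 0≤q =
  nonNegative⁻¹ _ {{nonNeg*nonNeg⇒nonNeg p {{nonNegative 0≤p}} q {{nonNegative 0≤q}}}}

coeff-+ₚ : ∀ p q k → coeff (p +ₚ q) k ≡ coeff p k + coeff q k
coeff-+ₚ []      q       k       = sym (+-identityˡ _)
coeff-+ₚ (a ∷ p) []      k       = sym (+-identityʳ _)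
coeff-+ₚ (a ∷ p) (b ∷ q) zero    = refl
coeff-+ₚ (a ∷ p) (b ∷ q) (suc k) = coeff-+ₚ p q k

coeff-scaleₚ : ∀ c p k → coeff (scaleₚ c p) k ≡ c * coeff p k
coeff-scaleₚ c []      k       = sym (*-zeroʳ c)
coeff-scaleₚ c (a ∷ p) zero    = refl
coeff-scaleₚ c (a ∷ p) (suc k) = coeff-scaleₚ c p k

coeff-∷*ₚ : ∀ a p q k → coeff ((a ∷ p) *ₚ q) k ≡ a * coeff q k + coeff (0ℚ ∷ p *ₚ q) k
coeff-∷*ₚ a p q k = trans (coeff-+ₚ (scaleₚ a q) _ k) (cong (_+ coeff (0ℚ ∷ p *ₚ q) k) (coeff-scaleₚ a q k))

coeff-[a]*ₚ : ∀ a q k → coeff ((a ∷ []) *ₚ q) k ≡ a * coeff q k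
coeff-[a]*ₚ a q zero    = trans (coeff-∷*ₚ a [] q zero) (+-identityʳ _)
coeff-[a]*ₚ a q (suc k) = trans (coeff-∷*ₚ a [] q (suc k)) (+-identityʳ _)

sumOver : {A : Set} → List A → (A → ℚ) → ℚ
sumOver xs g = foldr (λ x s → g x + s) 0ℚ xs

coeff-sumₚ : ∀ {A : Set} (F : A → Poly) xs k → coeff (sumₚ (map F xs)) k ≡ sumOver xs (λ x → coeff (F x) k)
coeff-sumₚ F []       k = refl
coeff-sumₚ F (x ∷ xs) k = trans (coeff-+ₚ (F x) _ k) (cong (coeff (F x) k +_) (coeff-sumₚ F xs k))

^ₚ-length : ∀ {A : Set} P (as : List A) → P ^ₚ length as ≡ prodₚ (map (λ _ → P) as)
^ₚ-length P []       = refl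
^ₚ-length P (a ∷ as) = cong (P *ₚ_) (^ₚ-length P as)

-- Stated coefficientwise so that both [−1] and [−1, 0] count as the factor 0·x − 1.
LinearFactor : ℚ → Poly → Set
LinearFactor t P = ∀ q k → coeff (P *ₚ q) k ≡ t * coeff (0ℚ ∷ q) k - coeff q k

linearFactor : ∀ t → LinearFactor t ((- 1ℚ) ∷ t ∷ [])
linearFactor t q zero    = trans (coeff-∷*ₚ (- 1ℚ) (t ∷ []) q zero) (rearrange t (coeff q zero))
  where
  rearrange : ∀ t c → - 1ℚ * c + 0ℚ ≡ t * 0ℚ - c
  rearrange = solve-∀ ℚ-ring
linearFactor t q (suc k) = begin
  coeff (((- 1ℚ) ∷ t ∷ []) *ₚ q) (suc k)          ≡⟨ coeff-∷*ₚ (- 1ℚ) (t ∷ []) q (suc k) ⟩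
  - 1ℚ * coeff q (suc k) + coeff ((t ∷ []) *ₚ q) k ≡⟨ cong (- 1ℚ * coeff q (suc k) +_) (coeff-[a]*ₚ t q k) ⟩
  - 1ℚ * coeff q (suc k) + t * coeff q k           ≡⟨ rearrange t (coeff q (suc k)) (coeff q k) ⟩
  t * coeff q k - coeff q (suc k)                  ∎
  where
  open ≡-Reasoning
  rearrange : ∀ t c c′ → - 1ℚ * c + t * c′ ≡ t * c′ - c
  rearrange = solve-∀ ℚ-ring

constantFactor : LinearFactor 0ℚ ((- 1ℚ) ∷ [])
constantFactor q k = trans (coeff-[a]*ₚ (- 1ℚ) q k) (rearrange (coeff q k) (coeff (0ℚ ∷ q) k))
  where
  rearrange : ∀ c c′ → - 1ℚ * c ≡ 0ℚ * c′ - c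
  rearrange = solve-∀ ℚ-ring

esym : ℕ → List ℚ → ℚ
esym zero    ts       = 1ℚ
esym (suc k) []       = 0ℚ
esym (suc k) (t ∷ ts) = esym (suc k) ts + t * esym k ts

esym-nonneg : ∀ k {ts} → All (0ℚ ≤_) ts → 0ℚ ≤ esym k ts
esym-nonneg zero    _            = nonNegative⁻¹ 1ℚ
esym-nonneg (suc k) []           = ≤-refl
esym-nonneg (suc k) (0≤t ∷ 0≤ts) = +-mono-≤ (esym-nonneg (suc k) 0≤ts) (*-nonNeg 0≤t (esym-nonneg k 0≤ts))

coeff-prodₚ : ∀ {A : Set} (P : A → Poly) (t : A → ℚ) → (∀ a → LinearFactor (t a) (P a)) →
  ∀ as k → coeff (prodₚ (map P as)) k ≡ -1^ length as * -1^ k * esym k (map t as)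
coeff-prodₚ P t linear []       zero    = refl
coeff-prodₚ P t linear []       (suc k) = sym (*-zeroʳ (1ℚ * -1^ suc k))
coeff-prodₚ P t linear (a ∷ as) zero    = begin
  coeff (P a *ₚ prodₚ (map P as)) zero                 ≡⟨ linear a _ zero ⟩
  t a * 0ℚ - coeff (prodₚ (map P as)) zero             ≡⟨ cong (λ c → t a * 0ℚ - c) (coeff-prodₚ P t linear as zero) ⟩
  t a * 0ℚ - -1^ length as * 1ℚ * 1ℚ                   ≡⟨ rearrange (t a) (-1^ length as) ⟩
  - -1^ length as * 1ℚ * 1ℚ                            ∎
  where
  open ≡-Reasoning
  rearrange : ∀ t s → t * 0ℚ - s * 1ℚ * 1ℚ ≡ - s * 1ℚ * 1ℚ
  rearrange = solve-∀ ℚ-ring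
coeff-prodₚ P t linear (a ∷ as) (suc k) = begin
  coeff (P a *ₚ prodₚ (map P as)) (suc k)                          ≡⟨ linear a _ (suc k) ⟩
  t a * coeff (prodₚ (map P as)) k - coeff (prodₚ (map P as)) (suc k)
    ≡⟨ cong₂ (λ c c′ → t a * c - c′) (coeff-prodₚ P t linear as k) (coeff-prodₚ P t linear as (suc k)) ⟩
  t a * (s * -1^ k * esym k ts) - s * - -1^ k * esym (suc k) ts
    ≡⟨ rearrange (t a) s (-1^ k) (esym k ts) (esym (suc k) ts) ⟩
  - s * - -1^ k * (esym (suc k) ts + t a * esym k ts)              ∎
  where
  open ≡-Reasoning
  s = -1^ length as
  ts = map t as
  rearrange : ∀ t s r e e′ → t * (s * r * e) - s * - r * e′ ≡ - s * - r * (e′ + t * e)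
  rearrange = solve-∀ ℚ-ring

-- Characters of the cube and their means

spin : Bool → ℚ
spin false = 1ℚ
spin true  = - 1ℚ

χ : List (Fin n) → Vector Bool n → ℚ
χ []      σ = 1ℚ
χ (i ∷ V) σ = spin (σ i) * χ V σ

χ-++ : ∀ V W (σ : Vector Bool n) → χ (V ++ W) σ ≡ χ V σ * χ W σ
χ-++ []      W σ = sym (*-identityˡ (χ W σ))
χ-++ (i ∷ V) W σ = trans (cong (spin (σ i) *_) (χ-++ V W σ)) (sym (*-assoc (spin (σ i)) (χ V σ) (χ W σ)))

Uₚ-linearFactor : ∀ (σ : Vector Bool n) i j → LinearFactor (1ℚ + χ (i ∷ j ∷ []) σ) (Uₚ (σ i) (σ j))
Uₚ-linearFactor σ i j = slope (σ i) (σ j)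
  where
  slope : ∀ x y → LinearFactor (1ℚ + spin x * (spin y * 1ℚ)) (Uₚ x y)
  slope false false = linearFactor (1ℚ + 1ℚ)
  slope false true  = constantFactor
  slope true  false = constantFactor
  slope true  true  = linearFactor (1ℚ + 1ℚ)

parity₀ : List (Fin (suc n)) → Bool
parity₀ []           = false
parity₀ (fzero  ∷ V) = not (parity₀ V)
parity₀ (fsuc i ∷ V) = parity₀ V

strip₀ : List (Fin (suc n)) → List (Fin n)
strip₀ []           = []
strip₀ (fzero  ∷ V) = strip₀ V
strip₀ (fsuc i ∷ V) = i ∷ strip₀ V

χ-∷ᵥ : ∀ V x (f : Vector Bool n) → χ V (x ∷ᵥ f) ≡ spin (parity₀ V ∧ x) * χ (strip₀ V) f
χ-∷ᵥ []           x f = refl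
χ-∷ᵥ (fzero  ∷ V) x f = begin
  spin x * χ V (x ∷ᵥ f)                                ≡⟨ cong (spin x *_) (χ-∷ᵥ V x f) ⟩
  spin x * (spin (parity₀ V ∧ x) * χ (strip₀ V) f)     ≡⟨ sym (*-assoc (spin x) _ _) ⟩
  spin x * spin (parity₀ V ∧ x) * χ (strip₀ V) f       ≡⟨ cong (_* χ (strip₀ V) f) (flip (parity₀ V) x) ⟩
  spin (not (parity₀ V) ∧ x) * χ (strip₀ V) f          ∎
  where
  open ≡-Reasoning
  flip : ∀ b x → spin x * spin (b ∧ x) ≡ spin (not b ∧ x)
  flip false false = refl
  flip false true  = refl
  flip true  false = refl
  flip true  true  = refl
χ-∷ᵥ (fsuc i ∷ V) x f =
  trans (cong (spin (f i) *_) (χ-∷ᵥ V x f)) (*-exchange (spin (f i)) (spin (parity₀ V ∧ x)) (χ (strip₀ V) f))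

sumOver-+ : ∀ {A : Set} xs (g h : A → ℚ) → sumOver xs (λ x → g x + h x) ≡ sumOver xs g + sumOver xs h
sumOver-+ []       g h = refl
sumOver-+ (x ∷ xs) g h =
  trans (cong (g x + h x +_) (sumOver-+ xs g h)) (interchange (g x) (h x) (sumOver xs g) (sumOver xs h))
  where
  interchange : ∀ a b c d → a + b + (c + d) ≡ a + c + (b + d)
  interchange = solve-∀ ℚ-ring

sumOver-* : ∀ {A : Set} xs c (g : A → ℚ) → sumOver xs (λ x → c * g x) ≡ c * sumOver xs g
sumOver-* []       c g = sym (*-zeroʳ c)
sumOver-* (x ∷ xs) c g =
  trans (cong (c * g x +_) (sumOver-* xs c g)) (sym (*-distribˡ-+ c (g x) (sumOver xs g)))

sumOver-cong : ∀ {A : Set} xs {g h : A → ℚ} → g ≗ h → sumOver xs g ≡ sumOver xs h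
sumOver-cong []       g≗h = refl
sumOver-cong (x ∷ xs) g≗h = cong₂ _+_ (g≗h x) (sumOver-cong xs g≗h)

sumOver-pairs : ∀ {A B : Set} xs (a b : A → B) (g : B → ℚ) →
  sumOver (concatMap (λ x → a x ∷ b x ∷ []) xs) g ≡ sumOver xs (λ x → g (a x) + g (b x))
sumOver-pairs []       a b g = refl
sumOver-pairs (x ∷ xs) a b g =
  trans (sym (+-assoc (g (a x)) (g (b x)) _)) (cong (g (a x) + g (b x) +_) (sumOver-pairs xs a b g))

𝔼 : (Vector Bool n → ℚ) → ℚ
𝔼 {n} g = halfPow n * sumOver (assignments n) g

𝔼-+ : ∀ (g h : Vector Bool n → ℚ) → 𝔼 (λ σ → g σ + h σ) ≡ 𝔼 g + 𝔼 h
𝔼-+ {n} g h = trans (cong (halfPow n *_) (sumOver-+ (assignments n) g h)) (*-distribˡ-+ (halfPow n) _ _)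

𝔼-* : ∀ c (g : Vector Bool n → ℚ) → 𝔼 (λ σ → c * g σ) ≡ c * 𝔼 g
𝔼-* {n} c g = trans (cong (halfPow n *_) (sumOver-* (assignments n) c g)) (*-exchange (halfPow n) c _)

𝔼-cong : {g h : Vector Bool n → ℚ} → g ≗ h → 𝔼 g ≡ 𝔼 h
𝔼-cong {n} g≗h = cong (halfPow n *_) (sumOver-cong (assignments n) g≗h)

𝔼-∷ᵥ : ∀ (g : Vector Bool (suc n) → ℚ) → 𝔼 g ≡ ½ * 𝔼 (λ f → g (false ∷ᵥ f) + g (true ∷ᵥ f))
𝔼-∷ᵥ {n} g = trans (cong (½ * halfPow n *_) (sumOver-pairs (assignments n) (false ∷ᵥ_) (true ∷ᵥ_) g))
                    (*-assoc ½ (halfPow n) _)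

𝔼-const : ∀ n c → 𝔼 {n} (λ _ → c) ≡ c
𝔼-const zero    c = trans (*-identityˡ (c + 0ℚ)) (+-identityʳ c)
𝔼-const (suc n) c = begin
  𝔼 {suc n} (λ _ → c)      ≡⟨ 𝔼-∷ᵥ {n} (λ _ → c) ⟩
  ½ * 𝔼 {n} (λ _ → c + c)  ≡⟨ cong (½ *_) (𝔼-const n (c + c)) ⟩
  ½ * (c + c)              ≡⟨ halve ½ c ⟩
  (½ + ½) * c              ≡⟨ *-identityˡ c ⟩
  c                        ∎
  where
  open ≡-Reasoning
  halve : ∀ h c → h * (c + c) ≡ (h + h) * c
  halve = solve-∀ ℚ-ring

𝔼-χ-nonneg : ∀ n (V : List (Fin n)) → 0ℚ ≤ 𝔼 (χ V)
𝔼-χ-nonneg zero    [] = nonNegative⁻¹ 1ℚ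
𝔼-χ-nonneg (suc n) V =
  subst (0ℚ ≤_) (sym halves)
        (*-nonNeg (nonNegative⁻¹ ½) (*-nonNeg (spins-nonneg b) (𝔼-χ-nonneg n (strip₀ V))))
  where
  open ≡-Reasoning
  b = parity₀ V
  spins : Bool → ℚ
  spins b = spin (b ∧ false) + spin (b ∧ true)
  spins-nonneg : ∀ b → 0ℚ ≤ spins b
  spins-nonneg false = nonNegative⁻¹ (1ℚ + 1ℚ)
  spins-nonneg true  = nonNegative⁻¹ 0ℚ
  halves : 𝔼 (χ V) ≡ ½ * (spins b * 𝔼 (χ (strip₀ V)))
  halves = begin
    𝔼 (χ V)                                            ≡⟨ 𝔼-∷ᵥ (χ V) ⟩
    ½ * 𝔼 (λ f → χ V (false ∷ᵥ f) + χ V (true ∷ᵥ f))  ≡⟨ cong (½ *_) (𝔼-cong split) ⟩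
    ½ * 𝔼 (λ f → spins b * χ (strip₀ V) f)             ≡⟨ cong (½ *_) (𝔼-* (spins b) (χ (strip₀ V))) ⟩
    ½ * (spins b * 𝔼 (χ (strip₀ V)))                   ∎
    where
    split : ∀ f → χ V (false ∷ᵥ f) + χ V (true ∷ᵥ f) ≡ spins b * χ (strip₀ V) f
    split f = trans (cong₂ _+_ (χ-∷ᵥ V false f) (χ-∷ᵥ V true f))
                    (sym (*-distribʳ-+ (χ (strip₀ V) f) (spin (b ∧ false)) (spin (b ∧ true))))

data FourierNonneg {n} : (Vector Bool n → ℚ) → Set where
  χ⁺     : ∀ V → FourierNonneg (χ V)
  _+⁺_   : ∀ {g h} → FourierNonneg g → FourierNonneg h → FourierNonneg (λ σ → g σ + h σ)
  scale⁺ : ∀ {c g} → 0ℚ ≤ c → FourierNonneg g → FourierNonneg (λ σ → c * g σ)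
  resp⁺  : ∀ {g h} → g ≗ h → FourierNonneg g → FourierNonneg h

0⁺ : FourierNonneg {n} (λ _ → 0ℚ)
0⁺ = scale⁺ ≤-refl (χ⁺ [])

χ*⁺ : ∀ V {g : Vector Bool n → ℚ} → FourierNonneg g → FourierNonneg (λ σ → χ V σ * g σ)
χ*⁺ V (χ⁺ W)                 = resp⁺ (χ-++ V W) (χ⁺ (V ++ W))
χ*⁺ V (_+⁺_ {g} {h} p q)     = resp⁺ (λ σ → sym (*-distribˡ-+ (χ V σ) (g σ) (h σ))) (χ*⁺ V p +⁺ χ*⁺ V q)
χ*⁺ V (scale⁺ {c} {g} 0≤c p) = resp⁺ (λ σ → *-exchange c (χ V σ) (g σ)) (scale⁺ 0≤c (χ*⁺ V p))
χ*⁺ V (resp⁺ g≗h p)          = resp⁺ (λ σ → cong (χ V σ *_) (g≗h σ)) (χ*⁺ V p)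

𝔼-nonneg : {g : Vector Bool n → ℚ} → FourierNonneg g → 0ℚ ≤ 𝔼 g
𝔼-nonneg {n} (χ⁺ V)             = 𝔼-χ-nonneg n V
𝔼-nonneg (_+⁺_ {g} {h} p q)     = subst (0ℚ ≤_) (sym (𝔼-+ g h)) (+-mono-≤ (𝔼-nonneg p) (𝔼-nonneg q))
𝔼-nonneg (scale⁺ {c} {g} 0≤c p) = subst (0ℚ ≤_) (sym (𝔼-* c g)) (*-nonNeg 0≤c (𝔼-nonneg p))
𝔼-nonneg (resp⁺ g≗h p)          = subst (0ℚ ≤_) (𝔼-cong g≗h) (𝔼-nonneg p)

𝔼-mono : ∀ (g h : Vector Bool n → ℚ) → FourierNonneg (λ σ → g σ - h σ) → 𝔼 h ≤ 𝔼 g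
𝔼-mono g h p = begin
  𝔼 h                               ≡⟨ +-identityˡ (𝔼 h) ⟨
  0ℚ + 𝔼 h                          ≤⟨ +-mono-≤ (𝔼-nonneg p) ≤-refl ⟩
  𝔼 (λ σ → g σ - h σ) + 𝔼 h         ≡⟨ 𝔼-+ (λ σ → g σ - h σ) h ⟨
  𝔼 (λ σ → g σ - h σ + h σ)         ≡⟨ 𝔼-cong (λ σ → cancel (g σ) (h σ)) ⟩
  𝔼 g                               ∎
  where
  open ≤-Reasoning
  cancel : ∀ a b → a - b + b ≡ a
  cancel = solve-∀ ℚ-ring

-- Elementary symmetric functions of 1 + χ

χs : List (List (Fin n)) → Vector Bool n → ℚ
χs S σ = foldr (λ V r → χ V σ * r) 1ℚ S

χs-↭ : ∀ {S T : List (List (Fin n))} σ → S ↭ T → χs S σ ≡ χs T σ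
χs-↭ σ ↭.refl                = refl
χs-↭ σ (↭.prep V p)          = cong (χ V σ *_) (χs-↭ σ p)
χs-↭ σ (↭.swap {ys = T} V W p) =
  trans (cong (λ r → χ V σ * (χ W σ * r)) (χs-↭ σ p)) (*-exchange (χ V σ) (χ W σ) (χs T σ))
χs-↭ σ (↭.trans p q)         = trans (χs-↭ σ p) (χs-↭ σ q)

ones : {A : Set} → List A → List ℚ
ones = map (λ _ → 1ℚ)

excess : ℕ → List (List (Fin n)) → Vector Bool n → ℚ
excess k Vs σ = esym k (map (λ V → 1ℚ + χ V σ) Vs) - esym k (ones Vs)

esym-ones-nonneg : ∀ k {A : Set} (xs : List A) → 0ℚ ≤ esym k (ones xs)
esym-ones-nonneg k xs = esym-nonneg k (All.map⁺ (All.universal (λ _ → nonNegative⁻¹ 1ℚ) xs))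

excess-increment : ℕ → List (Fin n) → List (List (Fin n)) → Vector Bool n → ℚ
excess-increment k V Vs σ = excess k Vs σ + χ V σ * excess k Vs σ + esym k (ones Vs) * χ V σ

excess-suc-∷ : ∀ k V (Vs : List (List (Fin n))) σ →
  excess (suc k) (V ∷ Vs) σ ≡ excess (suc k) Vs σ + excess-increment k V Vs σ
excess-suc-∷ k V Vs σ = expand (esym (suc k) ts) (esym k ts) (esym (suc k) (ones Vs)) (esym k (ones Vs)) (χ V σ)
  where
  ts = map (λ W → 1ℚ + χ W σ) Vs
  expand : ∀ a b c d x → a + (1ℚ + x) * b - (c + 1ℚ * d) ≡ a - c + (b - d + x * (b - d) + d * x)
  expand = solve-∀ ℚ-ring

excess-increment⁺ : ∀ k V (Vs : List (List (Fin n))) → FourierNonneg (excess-increment k V Vs)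
excess⁺ : ∀ k (Vs : List (List (Fin n))) → FourierNonneg (excess k Vs)

excess-increment⁺ k V Vs = (excess⁺ k Vs +⁺ χ*⁺ V (excess⁺ k Vs)) +⁺ scale⁺ (esym-ones-nonneg k Vs) (χ⁺ V)

excess⁺ zero    Vs       = 0⁺
excess⁺ (suc k) []       = 0⁺
excess⁺ (suc k) (V ∷ Vs) =
  resp⁺ (λ σ → sym (excess-suc-∷ k V Vs σ)) (excess⁺ (suc k) Vs +⁺ excess-increment⁺ k V Vs)

excess-≥-χs : ∀ {S Vs : List (List (Fin n))} → S ⊆ Vs → length S ≡ suc k →
  FourierNonneg (λ σ → excess (suc k) Vs σ - χs S σ)
excess-≥-χs {k = k} {S} (_∷ʳ_ {ys = Vs} W S⊆Vs) len =
  resp⁺ (λ σ → trans (reorder (excess (suc k) Vs σ) (excess-increment k W Vs σ) (χs S σ))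
                     (cong (_- χs S σ) (sym (excess-suc-∷ k W Vs σ))))
        (excess-≥-χs S⊆Vs len +⁺ excess-increment⁺ k W Vs)
  where
  reorder : ∀ a i m → a - m + i ≡ a + i - m
  reorder = solve-∀ ℚ-ring
excess-≥-χs {k = zero} {V ∷ []} (_∷_ {ys = Vs} refl _) refl =
  resp⁺ (λ σ → trans (reorder (excess 1 Vs σ) (χ V σ)) (cong (_- χ V σ * 1ℚ) (sym (excess-suc-∷ 0 V Vs σ))))
        (excess⁺ 1 Vs)
  where
  reorder : ∀ a x → a ≡ a + (0ℚ + x * 0ℚ + 1ℚ * x) - x * 1ℚ
  reorder = solve-∀ ℚ-ring
excess-≥-χs {k = suc k} {V ∷ S@(_ ∷ _)} (_∷_ {ys = Vs} refl S⊆Vs) refl =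
  resp⁺ (λ σ → trans (reorder (excess (suc (suc k)) Vs σ) (excess (suc k) Vs σ) (esym (suc k) (ones Vs))
                              (χ V σ) (χs S σ))
                     (cong (_- χ V σ * χs S σ) (sym (excess-suc-∷ (suc k) V Vs σ))))
        ((excess⁺ (suc (suc k)) Vs +⁺ (excess⁺ (suc k) Vs +⁺ scale⁺ (esym-ones-nonneg (suc k) Vs) (χ⁺ V)))
          +⁺ χ*⁺ V (excess-≥-χs S⊆Vs refl))
  where
  reorder : ∀ a b d x m → a + (b + d * x) + x * (b - m) ≡ a + (b + x * b + d * x) - x * m
  reorder = solve-∀ ℚ-ring

ends : Fin n × Fin n → List (Fin n)
ends p = proj₁ p ∷ proj₂ p ∷ []

coeff-ΔH : ∀ (H : Graph n) k → coeff (ΔH H) k ≡ -1^ e H * -1^ k * 𝔼 (excess k (map ends (edges H)))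
coeff-ΔH {n} H k = begin
  coeff (ΔH H) k                              ≡⟨ coeff-+ₚ (tH H) (negₚ (L ^ₚ e H)) k ⟩
  coeff (tH H) k + coeff (negₚ (L ^ₚ e H)) k  ≡⟨ cong₂ _+_ coeff-tH coeff-power ⟩
  𝔼 (λ σ → s * E σ) + - 1ℚ * (s * c)          ≡⟨ cong (_+ - 1ℚ * (s * c)) (𝔼-* s E) ⟩
  s * 𝔼 E + - 1ℚ * (s * c)                    ≡⟨ factor s (𝔼 E) c ⟩
  s * (𝔼 E + - c)                             ≡⟨ cong (λ m → s * (𝔼 E + m)) (𝔼-const n (- c)) ⟨
  s * (𝔼 E + 𝔼 {n} (λ _ → - c))               ≡⟨ cong (s *_) (𝔼-+ E (λ _ → - c)) ⟨
  s * 𝔼 (excess k Vs)                         ∎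
  where
  open ≡-Reasoning
  L  = (- 1ℚ) ∷ 1ℚ ∷ []
  Vs = map ends (edges H)
  s  = -1^ e H * -1^ k
  E  = λ σ → esym k (map (λ V → 1ℚ + χ V σ) Vs)
  c  = esym k (ones Vs)
  factor : ∀ s x c → s * x + - 1ℚ * (s * c) ≡ s * (x + - c)
  factor = solve-∀ ℚ-ring
  coeff-tH : coeff (tH H) k ≡ 𝔼 (λ σ → s * E σ)
  coeff-tH = trans (coeff-scaleₚ (halfPow n) (sumₚ (map cell (assignments n))) k)
                   (cong (halfPow n *_) (trans (coeff-sumₚ cell (assignments n) k)
                                               (sumOver-cong (assignments n) coeff-cell)))
    where
    cell : Vector Bool n → Poly
    cell σ = prodₚ (map (λ ij → Uₚ (σ (proj₁ ij)) (σ (proj₂ ij))) (edges H))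
    coeff-cell : ∀ σ → coeff (cell σ) k ≡ s * E σ
    coeff-cell σ =
      trans (coeff-prodₚ (λ ij → Uₚ (σ (proj₁ ij)) (σ (proj₂ ij))) (λ ij → 1ℚ + χ (ends ij) σ)
                         (λ ij → Uₚ-linearFactor σ (proj₁ ij) (proj₂ ij)) (edges H) k)
            (cong (λ ts → s * esym k ts) (map-∘ (edges H)))
  coeff-power : coeff (negₚ (L ^ₚ e H)) k ≡ - 1ℚ * (s * c)
  coeff-power = trans (coeff-scaleₚ (- 1ℚ) (L ^ₚ e H) k) (cong (- 1ℚ *_) (begin
    coeff (L ^ₚ e H) k
      ≡⟨ cong (λ P → coeff P k) (^ₚ-length L (edges H)) ⟩
    coeff (prodₚ (map (λ _ → L) (edges H))) k
      ≡⟨ coeff-prodₚ (λ _ → L) (λ _ → 1ℚ) (λ _ → linearFactor 1ℚ) (edges H) k ⟩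
    s * esym k (ones (edges H))
      ≡⟨ cong (λ ts → s * esym k ts) (map-∘ (edges H)) ⟩
    s * c
      ∎))

-- Triangles

module _ {A : Set} where

  insert-⊆ : ∀ {x : A} {xs ys} → x ∈ ys → x ∉ xs → xs ⊆ ys → ∃[ zs ] zs ⊆ ys × zs ↭ x ∷ xs
  insert-⊆ ()          x∉xs []
  insert-⊆ (here refl) x∉xs (y ∷ʳ xs⊆ys) = _ , refl ∷ xs⊆ys , ↭-refl
  insert-⊆ (there x∈ys) x∉xs (y ∷ʳ xs⊆ys) =
    let zs , zs⊆ys , zs↭ = insert-⊆ x∈ys x∉xs xs⊆ys in zs , y ∷ʳ zs⊆ys , zs↭
  insert-⊆ (here refl) x∉xs (refl ∷ xs⊆ys) = ⊥-elim (x∉xs (here refl))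
  insert-⊆ (there x∈ys) x∉xs (refl ∷ xs⊆ys) =
    let zs , zs⊆ys , zs↭ = insert-⊆ x∈ys (x∉xs ∘ there) xs⊆ys
    in _ ∷ zs , refl ∷ zs⊆ys , ↭.trans (↭.prep _ zs↭) (↭.swap _ _ ↭-refl)

  unique-↭-sublist : ∀ {xs ys : List A} → Unique xs → All (_∈ ys) xs → ∃[ zs ] zs ⊆ ys × zs ↭ xs
  unique-↭-sublist {ys = ys} [] [] = [] , minimum ys , ↭-refl
  unique-↭-sublist (x≢xs ∷ xs-unique) (x∈ys ∷ xs∈ys) =
    let zs , zs⊆ys , zs↭xs = unique-↭-sublist xs-unique xs∈ys
        x∉zs x∈zs = All.lookup x≢xs (∈-resp-↭ zs↭xs x∈zs) refl
        zs′ , zs′⊆ys , zs′↭ = insert-⊆ x∈ys x∉zs zs⊆ys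
    in zs′ , zs′⊆ys , ↭.trans zs′↭ (↭.prep _ zs↭xs)

Joins : Fin n × Fin n → Fin n → Fin n → Set
Joins p x y = p ≡ (x , y) ⊎ p ≡ (y , x)

joins-injective : ∀ {p x y z} → Joins {n} p x y → Joins p x z → y ≡ z
joins-injective (inj₁ refl) (inj₁ refl) = refl
joins-injective (inj₁ refl) (inj₂ refl) = refl
joins-injective (inj₂ refl) (inj₁ refl) = refl
joins-injective (inj₂ refl) (inj₂ refl) = refl

χ-ends : ∀ {p x y} (σ : Vector Bool n) → Joins p x y → χ (ends p) σ ≡ spin (σ x) * spin (σ y)
χ-ends {x = x} {y} σ (inj₁ refl) = cong (spin (σ x) *_) (*-identityʳ (spin (σ y)))
χ-ends {x = x} {y} σ (inj₂ refl) =
  trans (cong (spin (σ y) *_) (*-identityʳ (spin (σ x)))) (*-comm (spin (σ y)) (spin (σ x)))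

adjacent-distinct : ∀ (G : Graph n) {x y} → T (adj G x y) → x ≢ y
adjacent-distinct G {x} x~x refl = subst T (irrefl G x) x~x

∈-edges : ∀ (G : Graph n) {i j} → toℕ i <ℕ toℕ j → T (adj G i j) → (i , j) ∈ edges G
∈-edges G {i} {j} i<j i~j =
  ∈-filter⁺ _ (∈-cartesianProduct⁺ (∈-allFin i) (∈-allFin j)) (Equivalence.from T-∧ (<⇒<ᵇ i<j , i~j))

edge-joins : ∀ (G : Graph n) {x y} → T (adj G x y) → ∃[ p ] p ∈ edges G × Joins p x y
edge-joins G {x} {y} x~y with <-cmp (toℕ x) (toℕ y)
... | tri< x<y _ _ = (x , y) , ∈-edges G x<y x~y , inj₁ refl
... | tri≈ _ x≡y _ = ⊥-elim (adjacent-distinct G x~y (toℕ-injective x≡y))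
... | tri> _ _ y<x = (y , x) , ∈-edges G y<x (subst T (Graph.sym G x y) x~y) , inj₂ refl

triangle-edges-unique : ∀ (G : Graph n) {a b c p q r} → T (adj G a b) → T (adj G b c) → T (adj G a c) →
  Joins p a b → Joins q b c → Joins r a c → Unique (p ∷ q ∷ r ∷ [])
triangle-edges-unique G a~b b~c a~c p-ab q-bc r-ac = (p≢q ∷ p≢r ∷ []) ∷ (q≢r ∷ []) ∷ [] ∷ []
  where
  p≢q = λ { refl → adjacent-distinct G a~c (joins-injective (Sum.swap p-ab) q-bc) }
  p≢r = λ { refl → adjacent-distinct G b~c (joins-injective p-ab r-ac) }
  q≢r = λ { refl → adjacent-distinct G a~b (sym (joins-injective (Sum.swap q-bc) (Sum.swap r-ac))) }

χs-triangle : ∀ {a b c p q r} (σ : Vector Bool n) → Joins p a b → Joins q b c → Joins r a c →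
  χs (map ends (p ∷ q ∷ r ∷ [])) σ ≡ 1ℚ
χs-triangle {a = a} {b} {c} σ p-ab q-bc r-ac =
  trans (cong₂ _*_ (χ-ends σ p-ab) (cong₂ (λ v w → v * (w * 1ℚ)) (χ-ends σ q-bc) (χ-ends σ r-ac)))
        (spin-cycle (σ a) (σ b) (σ c))
  where
  spin-cycle : ∀ x y z → spin x * spin y * (spin y * spin z * (spin x * spin z * 1ℚ)) ≡ 1ℚ
  spin-cycle false false false = refl
  spin-cycle false false true  = refl
  spin-cycle false true  false = refl
  spin-cycle false true  true  = refl
  spin-cycle true  false false = refl
  spin-cycle true  false true  = refl
  spin-cycle true  true  false = refl
  spin-cycle true  true  true  = refl

𝔼-excess₃-≥1 : ∀ (G : Graph n) → ContainsTriangle G → 1ℚ ≤ 𝔼 (excess 3 (map ends (edges G)))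
𝔼-excess₃-≥1 {n} G (a , b , c , a~b , b~c , a~c)
  with edge-joins G a~b | edge-joins G b~c | edge-joins G a~c
... | p , p∈G , p-ab | q , q∈G , q-bc | r , r∈G , r-ac
  with unique-↭-sublist (triangle-edges-unique G a~b b~c a~c p-ab q-bc r-ac) (p∈G ∷ q∈G ∷ r∈G ∷ [])
... | S , S⊆G , S↭pqr = begin
  1ℚ                                   ≡⟨ 𝔼-const n 1ℚ ⟨
  𝔼 {n} (λ _ → 1ℚ)                     ≡⟨ 𝔼-cong (λ σ → χs-triangle σ p-ab q-bc r-ac) ⟨
  𝔼 (χs (map ends (p ∷ q ∷ r ∷ [])))   ≡⟨ 𝔼-cong (λ σ → χs-↭ σ (↭.map⁺ ends S↭pqr)) ⟨
  𝔼 (χs (map ends S))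
    ≤⟨ 𝔼-mono (excess 3 Es) (χs (map ends S)) (excess-≥-χs (⊆.map⁺ ends S⊆G) |ends-S|≡3) ⟩
  𝔼 (excess 3 Es)                      ∎
  where
  open ≤-Reasoning
  Es = map ends (edges G)
  |ends-S|≡3 : length (map ends S) ≡ 3
  |ends-S|≡3 = trans (length-map ends S) (↭-length S↭pqr)

lemma4p2 : ∀ {n : ℕ} (H : Graph n) → ContainsTriangle H →
    ((e H % 2 ≡ 1 → 0ℚ < coeff (ΔH H) 3) × (e H % 2 ≡ 0 → coeff (ΔH H) 3 < 0ℚ))
lemma4p2 H triangle = positive-if-odd , negative-if-even
  where
  X = 𝔼 (excess 3 (map ends (edges H)))
  0<X : 0ℚ < X
  0<X = <-≤-trans (positive⁻¹ 1ℚ) (𝔼-excess₃-≥1 H triangle)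
  positive-if-odd : e H % 2 ≡ 1 → 0ℚ < coeff (ΔH H) 3
  positive-if-odd odd = subst (0ℚ <_) (sym (begin
    coeff (ΔH H) 3           ≡⟨ coeff-ΔH H 3 ⟩
    -1^ e H * -1^ 3 * X      ≡⟨ cong (λ s → s * -1^ 3 * X) (-1^-odd (e H) odd) ⟩
    1ℚ * X                   ≡⟨ *-identityˡ X ⟩
    X                        ∎)) 0<X
    where open ≡-Reasoning
  negative-if-even : e H % 2 ≡ 0 → coeff (ΔH H) 3 < 0ℚ
  negative-if-even even = subst (_< 0ℚ) (sym (begin
    coeff (ΔH H) 3           ≡⟨ coeff-ΔH H 3 ⟩
    -1^ e H * -1^ 3 * X      ≡⟨ cong (λ s → s * -1^ 3 * X) (-1^-even (e H) even) ⟩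
    - 1ℚ * X                 ≡⟨ neg-distribˡ-* 1ℚ X ⟨
    - (1ℚ * X)               ≡⟨ cong -_ (*-identityˡ X) ⟩
    - X                      ∎)) (neg-antimono-< 0<X)
    where open ≡-Reasoning
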